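{- For $n\ge 2$, every $F$-orbit on the set of primitive $DUU$-avoiding Dyck $n$-paths has length $2^{k}$, where $k$ is the number of bits in the base-$2$ expansion of $n-2$ (with $k=0$ when $n=2$).
   Context: Dyck paths are words in $U$ (upstep) and $D$ (downstep) with equally many of each such that every prefix has at least as many $U$'s as $D$'s; size = number of $U$'s; $\epsilon$ = empty path; powers denote repetition. A nonempty Dyck path is primitive if no nonempty proper prefix is a Dyck path; every nonempty Dyck path is uniquely a concatenation of primitive ones (its components). A Dyck path avoids $DUU$ if it has no three consecutive steps $D,U,U$. The bijection $F$ on Dyck paths: $F(\epsilon)=\epsilon$; if $P$ has components $P_1,\dots,P_r$, $r\ge2$, then $F(P)=F(P_1)\cdots F(P_r)$; a primitive $P$ is uniquely $P=UQ(UD)^iD$ with $i\ge0$ and $Q$ a Dyck path that is empty or ends with $DD$, and $F(P)=U^{i+1}F(R)UDD^{i+1}$ if $Q$ is primitive, $Q=URD$, while $F(P)=U^{i+1}F(Q)D^{i+1}$ if $Q$ is not primitive (including $Q=\epsilon$). $F$ maps the set of primitive $DUU$-avoiding Dyck $n$-paths to itself; an $F$-orbit is a cycle of this permutation. -}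

module Defs where

open import Data.Nat using (ℕ; zero; suc; _+_; _∸_; _<_; _≤_)
open import Data.Nat.Logarithm using (⌊log₂_⌋)
open import Data.Bool using (Bool; true; false)
open import Data.List using (List; []; _∷_; _++_; length; concat; map; reverse; replicate)
open import Data.Maybe using (Maybe; just; nothing)
open import Data.Product using (_×_; _,_; ∃-syntax)
open import Relation.Binary.PropositionalEquality using (_≡_; _≢_)
open import Relation.Nullary using (¬_)

data Step : Set where
  U D : Step

Path : Set
Path = List Step

walk : ℕ → Path → Bool
walk zero    []      = true
walk (suc _) []      = false
walk h       (U ∷ w) = walk (suc h) w
walk zero    (D ∷ w) = false
walk (suc h) (D ∷ w) = walk h w

IsDyck : Path → Set
IsDyck w = walk 0 w ≡ true

size : Path → ℕ
size []      = 0
size (U ∷ w) = suc (size w)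
size (D ∷ w) = size w

IsPrimitive : Path → Set
IsPrimitive w = IsDyck w × w ≢ [] ×
  (∀ p s → p ++ s ≡ w → p ≢ [] → s ≢ [] → ¬ IsDyck p)

AvoidsDUU : Path → Set
AvoidsDUU w = ¬ (∃[ a ] ∃[ b ] w ≡ a ++ (D ∷ U ∷ U ∷ b))

-- Decomposition of a Dyck path into its components (primitive factors).
-- comps h cur w : cur is the reversed current (unfinished) component,
-- h the current height.
comps : ℕ → Path → Path → List Path
comps h       cur []      = []   -- only reached for Dyck input when cur = []
comps h       cur (U ∷ w) = comps (suc h) (U ∷ cur) w
comps zero    cur (D ∷ w) = []   -- not reached for Dyck input
comps (suc zero) cur (D ∷ w) = reverse (D ∷ cur) ∷ comps zero [] w
comps (suc (suc h)) cur (D ∷ w) = comps (suc h) (D ∷ cur) w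

components : Path → List Path
components = comps 0 []

interior : Path → Path
interior []      = []
interior (_ ∷ w) = dropLast w
  where
  dropLast : Path → Path
  dropLast []      = []
  dropLast (x ∷ []) = []
  dropLast (x ∷ y ∷ ys) = x ∷ dropLast (y ∷ ys)

-- Given the reversed body, strip trailing UD pairs (leading D,U in reverse):
-- body = Q (UD)^i with Q empty or not ending with UD (hence ending with DD).
stripUD : Path → ℕ × Path   -- input/output reversed
stripUD (D ∷ U ∷ w) with stripUD w
... | i , q = suc i , q
stripUD w = 0 , w

UDs : ℕ → Path
UDs zero    = []
UDs (suc i) = U ∷ D ∷ UDs i

Us Ds : ℕ → Path
Us i = replicate i U
Ds i = replicate i D

-- The bijection F, with fuel (each recursive call is on a strictly shorter
-- path, so fuel = length of the path suffices; see F below).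
Ffuel : ℕ → Path → Path
Ffuel zero w = w
Ffuel (suc f) w with components w
... | []            = []
... | p ∷ q ∷ ps    = concat (map (Ffuel f) (p ∷ q ∷ ps))
... | P ∷ [] with stripUD (reverse (interior P))
...   | i , rq with components (reverse rq)
...     | Q₁ ∷ [] = Us (suc i) ++ Ffuel f (interior Q₁) ++ U ∷ D ∷ Ds (suc i)
...     | _       = Us (suc i) ++ Ffuel f (reverse rq) ++ Ds (suc i)

F : Path → Path
F w = Ffuel (length w) w

F^ : ℕ → Path → Path
F^ zero    w = w
F^ (suc m) w = F (F^ m w)

bitLength : ℕ → ℕ
bitLength zero    = 0
bitLength (suc m) = suc ⌊log₂ (suc m) ⌋

PrimDUU : ℕ → Path → Set
PrimDUU n w = IsPrimitive w × AvoidsDUU w × size w ≡ n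

OrbitLength : Path → ℕ → Set
OrbitLength w L = 1 ≤ L × F^ L w ≡ w × (∀ m → 1 ≤ m → m < L → F^ m w ≢ w)

-- Encode bit strings by Dyck paths: a leading 0 appends a peak UD to the code of the rest and
-- a leading 1 wraps it in U…D, so code (0ʲ ++ 1 ∷ y) = U (code y) D (UD)ʲ is the decomposition
-- U Q (UD)ⁱ D that defines F. The primitive DUU-avoiding Dyck n-paths are exactly the paths
-- code (1 ∷ x) with x of length n − 2, and F ∘ code = code ∘ xorScan false, where xorScan c
-- replaces each bit by the xor of c with all bits up to it; so F acts on x as xorScan true.
-- Applying xorScan c twice acts on the even-indexed bits as xorScan false and on the odd-indexed
-- bits as xorScan c. Halving the length, xorScan true has period 2ᵏ once the length is below
-- 2ᵏ; and since the first bit flips at every step, every period is even, and recursing on the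
-- odd-indexed bits shows that it is a multiple of 2 ^ bitLength (length x).

module Submission where

open import Defs

open import Data.Bool using (Bool; true; false; not; _xor_)
open import Data.Bool.Properties using (xor-assoc; xor-same; xor-identityʳ; not-involutive; not-¬)
open import Data.List using (List; []; _∷_; _++_; _∷ʳ_; _ʳ++_; length; head; replicate; reverse; concat; map)
open import Data.List.Properties
  using (∷-injective; ∷-injectiveʳ; ∷ʳ-injectiveˡ; ∷ʳ-injectiveʳ; ++-assoc; ++-identityʳ; ++-cancelʳ;
         length-++-≤ˡ; length-++-≤ʳ; length-++; ʳ++-ʳ++; reverse-++; reverse-involutive)
open import Data.Maybe using (just) renaming (map to mapMaybe)
open import Data.Maybe.Properties using (just-injective)
open import Data.Nat using (ℕ; zero; suc; >-nonZero; _+_; _∸_; _*_; _^_; _≤_; _<_; z≤n; s≤s; ⌊_/2⌋; ⌈_/2⌉)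
open import Data.Nat.Properties
  using (≤-refl; ≤-trans; ≤-reflexive; <⇒≤; <⇒≱; n≤1+n; +-comm; +-identityʳ; *-comm; +-monoˡ-≤; +-monoʳ-≤;
         *-monoʳ-≤; m^n>0; ⌈n/2⌉-mono; ⌊n/2⌋-mono; ⌊n/2⌋≤⌈n/2⌉; ⌊n/2⌋+⌈n/2⌉≡n; ⌊n/2⌋<n; n≡⌈n+n/2⌉; n≡⌊n+n/2⌋;
         module ≤-Reasoning)
open import Data.Nat.Divisibility using (∣⇒≤; _∣_; divides; _∣0; n∣m*n; ∣m∣n⇒∣m+n; ∣-refl; *-monoˡ-∣)
open import Data.Nat.Logarithm using (⌊log₂_⌋)
open import Data.Nat.Logarithm.Core using (⌊log2⌋)
open import Data.Nat.Induction using (<-wellFounded)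
open import Induction.WellFounded using (Acc; acc)
open import Data.Nat.GeneralisedArithmetic using (fold; fold-*)
open import Data.Product using (_×_; _,_; proj₁; proj₂; map₁; ∃-syntax)
open import Data.Sum using (_⊎_; inj₁; inj₂)
open import Function using (_∘_)
open import Relation.Binary.PropositionalEquality
  using (_≡_; _≢_; refl; sym; trans; cong; cong₂; subst; module ≡-Reasoning)
open import Relation.Nullary using (contradiction)

xorScan : Bool → List Bool → List Bool
xorScan c []       = []
xorScan c (b ∷ bs) = (c xor b) ∷ xorScan (c xor b) bs

mutual
  evens : {A : Set} → List A → List A
  evens []       = []
  evens (a ∷ as) = a ∷ odds as

  odds : {A : Set} → List A → List A
  odds []       = []
  odds (a ∷ as) = evens as

evens-odds-injective : {A : Set} (xs ys : List A) →
  evens xs ≡ evens ys → odds xs ≡ odds ys → xs ≡ ys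
evens-odds-injective []       []       _  _  = refl
evens-odds-injective (x ∷ xs) (y ∷ ys) ee eo with refl , eo′ ← ∷-injective ee =
  cong (x ∷_) (evens-odds-injective xs ys eo eo′)
evens-odds-injective []       (y ∷ ys) () _
evens-odds-injective (x ∷ xs) []       () _

mutual
  length-evens : {A : Set} (xs : List A) → length (evens xs) ≡ ⌈ length xs /2⌉
  length-evens []       = refl
  length-evens (x ∷ xs) = cong suc (length-odds xs)

  length-odds : {A : Set} (xs : List A) → length (odds xs) ≡ ⌊ length xs /2⌋
  length-odds []       = refl
  length-odds (x ∷ xs) = length-evens xs

xor-cancel-middle : ∀ u c b → (u xor c) xor (c xor b) ≡ u xor b
xor-cancel-middle u c b = begin
  (u xor c) xor (c xor b)  ≡⟨ xor-assoc u c (c xor b) ⟩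
  u xor (c xor (c xor b))  ≡⟨ cong (u xor_) (sym (xor-assoc c c b)) ⟩
  u xor ((c xor c) xor b)  ≡⟨ cong (λ d → u xor (d xor b)) (xor-same c) ⟩
  u xor b                  ∎
  where open ≡-Reasoning

xor-cancelʳ : ∀ x y → (x xor y) xor y ≡ x
xor-cancelʳ x y = begin
  (x xor y) xor y  ≡⟨ xor-assoc x y y ⟩
  x xor (y xor y)  ≡⟨ cong (x xor_) (xor-same y) ⟩
  x xor false      ≡⟨ xor-identityʳ x ⟩
  x                ∎
  where open ≡-Reasoning

evens-xorScan² : ∀ u t x → evens (xorScan u (xorScan t x)) ≡ xorScan (u xor t) (evens x)
evens-xorScan² u t []          = refl
evens-xorScan² u t (a ∷ [])    = cong (_∷ []) (sym (xor-assoc u t a))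
evens-xorScan² u t (a ∷ b ∷ x) = cong₂ _∷_ (sym (xor-assoc u t a)) (begin
  evens (xorScan v (xorScan t′ x))  ≡⟨ evens-xorScan² v t′ x ⟩
  xorScan (v xor t′) (evens x)      ≡⟨ cong (λ d → xorScan d (evens x)) (xor-cancelʳ (u xor (t xor a)) t′) ⟩
  xorScan (u xor (t xor a)) (evens x) ≡⟨ cong (λ d → xorScan d (evens x)) (sym (xor-assoc u t a)) ⟩
  xorScan ((u xor t) xor a) (evens x) ∎)
  where
  open ≡-Reasoning
  t′ = (t xor a) xor b
  v  = (u xor (t xor a)) xor t′

odds-xorScan² : ∀ u t x → odds (xorScan u (xorScan t x)) ≡ xorScan u (odds x)
odds-xorScan² u t []          = refl
odds-xorScan² u t (a ∷ [])    = refl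
odds-xorScan² u t (a ∷ b ∷ x) =
  trans (cong (v ∷_) (odds-xorScan² v ((t xor a) xor b) x))
        (cong (λ d → d ∷ xorScan d (odds x)) (xor-cancel-middle u (t xor a) b))
  where v = (u xor (t xor a)) xor ((t xor a) xor b)

evens-fold-xorScan² : ∀ s x m →
  evens (fold x (λ z → xorScan s (xorScan s z)) m) ≡ fold (evens x) (xorScan false) m
evens-fold-xorScan² s x zero    = refl
evens-fold-xorScan² s x (suc m) = begin
  evens (xorScan s (xorScan s y))      ≡⟨ evens-xorScan² s s y ⟩
  xorScan (s xor s) (evens y)          ≡⟨ cong₂ xorScan (xor-same s) (evens-fold-xorScan² s x m) ⟩
  xorScan false (fold (evens x) (xorScan false) m) ∎
  where
  open ≡-Reasoning
  y = fold x (λ z → xorScan s (xorScan s z)) m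

odds-fold-xorScan² : ∀ s x m →
  odds (fold x (λ z → xorScan s (xorScan s z)) m) ≡ fold (odds x) (xorScan s) m
odds-fold-xorScan² s x zero    = refl
odds-fold-xorScan² s x (suc m) =
  trans (odds-xorScan² s s (fold x (λ z → xorScan s (xorScan s z)) m))
        (cong (xorScan s) (odds-fold-xorScan² s x m))

n≤2m⇒⌈n/2⌉≤m : ∀ {n} m → n ≤ 2 * m → ⌈ n /2⌉ ≤ m
n≤2m⇒⌈n/2⌉≤m {n} m n≤2m = begin
  ⌈ n /2⌉           ≤⟨ ⌈n/2⌉-mono n≤2m ⟩
  ⌈ m + (m + 0) /2⌉ ≡⟨ cong (λ k → ⌈ m + k /2⌉) (+-identityʳ m) ⟩
  ⌈ m + m /2⌉       ≡⟨ n≡⌈n+n/2⌉ m ⟨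
  m                 ∎
  where open ≤-Reasoning

2m≤n⇒m≤⌊n/2⌋ : ∀ {n} m → 2 * m ≤ n → m ≤ ⌊ n /2⌋
2m≤n⇒m≤⌊n/2⌋ {n} m 2m≤n = begin
  m                 ≡⟨ n≡⌊n+n/2⌋ m ⟩
  ⌊ m + m /2⌋       ≡⟨ cong (λ k → ⌊ m + k /2⌋) (+-identityʳ m) ⟨
  ⌊ m + (m + 0) /2⌋ ≤⟨ ⌊n/2⌋-mono 2m≤n ⟩
  ⌊ n /2⌋           ∎
  where open ≤-Reasoning

n≤2*⌈n/2⌉ : ∀ n → n ≤ 2 * ⌈ n /2⌉
n≤2*⌈n/2⌉ n = begin
  n                  ≡⟨ ⌊n/2⌋+⌈n/2⌉≡n n ⟨
  ⌊ n /2⌋ + ⌈ n /2⌉  ≤⟨ +-monoˡ-≤ ⌈ n /2⌉ (⌊n/2⌋≤⌈n/2⌉ n) ⟩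
  ⌈ n /2⌉ + ⌈ n /2⌉  ≡⟨ cong (⌈ n /2⌉ +_) (+-identityʳ ⌈ n /2⌉) ⟨
  2 * ⌈ n /2⌉        ∎
  where open ≤-Reasoning

2*⌊n/2⌋≤n : ∀ n → 2 * ⌊ n /2⌋ ≤ n
2*⌊n/2⌋≤n n = begin
  2 * ⌊ n /2⌋        ≡⟨ cong (⌊ n /2⌋ +_) (+-identityʳ ⌊ n /2⌋) ⟩
  ⌊ n /2⌋ + ⌊ n /2⌋  ≤⟨ +-monoʳ-≤ ⌊ n /2⌋ (⌊n/2⌋≤⌈n/2⌉ n) ⟩
  ⌊ n /2⌋ + ⌈ n /2⌉  ≡⟨ ⌊n/2⌋+⌈n/2⌉≡n n ⟩
  n                  ∎
  where open ≤-Reasoning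

2^suc≡2^*2 : ∀ k → 2 ^ suc k ≡ 2 ^ k * 2
2^suc≡2^*2 k = *-comm 2 (2 ^ k)

fold-xorScan-double-fixed : ∀ s m x →
  fold (evens x) (xorScan false) m ≡ evens x → fold (odds x) (xorScan s) m ≡ odds x →
  fold x (xorScan s) (m * 2) ≡ x
fold-xorScan-double-fixed s m x fixes-evens fixes-odds = begin
  fold x (xorScan s) (m * 2)                       ≡⟨ fold-* x (xorScan s) m ⟩
  fold x (λ z → xorScan s (xorScan s z)) m         ≡⟨ evens-odds-injective _ x
                                                        (trans (evens-fold-xorScan² s x m) fixes-evens)
                                                        (trans (odds-fold-xorScan² s x m) fixes-odds) ⟩
  x                                                ∎
  where open ≡-Reasoning

xorScan-false-period : ∀ k x → length x ≤ 2 ^ k → fold x (xorScan false) (2 ^ k) ≡ x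
xorScan-false-period zero    []          _        = refl
xorScan-false-period zero    (a ∷ [])    _        = refl
xorScan-false-period zero    (a ∷ b ∷ x) (s≤s ())
xorScan-false-period (suc k) x           len≤ =
  trans (cong (fold x (xorScan false)) (2^suc≡2^*2 k))
        (fold-xorScan-double-fixed false (2 ^ k) x
          (xorScan-false-period k (evens x) (≤-trans (≤-reflexive (length-evens x)) ⌈len/2⌉≤))
          (xorScan-false-period k (odds x)
            (≤-trans (≤-reflexive (length-odds x)) (≤-trans (⌊n/2⌋≤⌈n/2⌉ (length x)) ⌈len/2⌉≤))))
  where
  ⌈len/2⌉≤ : ⌈ length x /2⌉ ≤ 2 ^ k
  ⌈len/2⌉≤ = n≤2m⇒⌈n/2⌉≤m (2 ^ k) len≤

xorScan-true-period : ∀ k x → length x < 2 ^ k → fold x (xorScan true) (2 ^ k) ≡ x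
xorScan-true-period zero    []      _        = refl
xorScan-true-period zero    (a ∷ x) (s≤s ())
xorScan-true-period (suc k) x       len< =
  trans (cong (fold x (xorScan true)) (2^suc≡2^*2 k))
        (fold-xorScan-double-fixed true (2 ^ k) x
          (xorScan-false-period k (evens x)
            (≤-trans (≤-reflexive (length-evens x)) (n≤2m⇒⌈n/2⌉≤m (2 ^ k) (<⇒≤ len<))))
          (xorScan-true-period k (odds x)
            (≤-trans (s≤s (≤-reflexive (length-odds x))) (n≤2m⇒⌈n/2⌉≤m (2 ^ k) len<))))

head-xorScan-true : ∀ x → head (xorScan true x) ≡ mapMaybe not (head x)
head-xorScan-true []      = refl
head-xorScan-true (b ∷ x) = refl

head-fold-xorScan-true : ∀ b y m → head (fold (b ∷ y) (xorScan true) m) ≡ just (fold b not m)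
head-fold-xorScan-true b y zero    = refl
head-fold-xorScan-true b y (suc m) =
  trans (head-xorScan-true (fold (b ∷ y) (xorScan true) m))
        (cong (mapMaybe not) (head-fold-xorScan-true b y m))

fold-not-fixed⇒even : ∀ b m → fold b not m ≡ b → 2 ∣ m
fold-not-fixed⇒even b zero          _   = 2 ∣0
fold-not-fixed⇒even b (suc zero)    e   = contradiction (sym e) (not-¬ refl)
fold-not-fixed⇒even b (suc (suc m)) e   =
  ∣m∣n⇒∣m+n ∣-refl (fold-not-fixed⇒even b m (trans (sym (not-involutive _)) e))

xorScan-true-period-even : ∀ b y m → fold (b ∷ y) (xorScan true) m ≡ b ∷ y → 2 ∣ m
xorScan-true-period-even b y m e = fold-not-fixed⇒even b m
  (just-injective (trans (sym (head-fold-xorScan-true b y m)) (cong head e)))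

xorScan-true-period-divisible : ∀ k x m → 2 ^ k ≤ length x →
  fold x (xorScan true) m ≡ x → 2 ^ suc k ∣ m
xorScan-true-period-divisible k [] m 2^k≤0 _ = contradiction 2^k≤0 (<⇒≱ (m^n>0 2 k))
xorScan-true-period-divisible k (b ∷ y) m 2^k≤ e with xorScan-true-period-even b y m e
xorScan-true-period-divisible zero    (b ∷ y) .(q * 2) 2^k≤ e | divides q refl = n∣m*n q
xorScan-true-period-divisible (suc k) (b ∷ y) .(q * 2) 2^k≤ e | divides q refl =
  subst (_∣ q * 2) (sym (2^suc≡2^*2 (suc k)))
    (*-monoˡ-∣ 2 (xorScan-true-period-divisible k (odds x) q odds≥ fixes-odds))
  where
  x = b ∷ y
  odds≥ : 2 ^ k ≤ length (odds x)
  odds≥ = ≤-trans (2m≤n⇒m≤⌊n/2⌋ (2 ^ k) 2^k≤) (≤-reflexive (sym (length-odds x)))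
  fixes-odds : fold (odds x) (xorScan true) q ≡ odds x
  fixes-odds = begin
    fold (odds x) (xorScan true) q                       ≡⟨ odds-fold-xorScan² true x q ⟨
    odds (fold x (λ z → xorScan true (xorScan true z)) q) ≡⟨ cong odds (fold-* x (xorScan true) q) ⟨
    odds (fold x (xorScan true) (q * 2))                 ≡⟨ cong odds e ⟩
    odds x                                               ∎
    where open ≡-Reasoning

2^⌊log2⌋-bounds : ∀ n (rec : Acc _<_ (suc n)) →
  2 ^ ⌊log2⌋ (suc n) rec ≤ suc n × suc n < 2 ^ suc (⌊log2⌋ (suc n) rec)
2^⌊log2⌋-bounds zero    _        = s≤s z≤n , s≤s (s≤s z≤n)
2^⌊log2⌋-bounds (suc n) (acc rs) with lower , upper ← 2^⌊log2⌋-bounds ⌊ n /2⌋ (rs (⌊n/2⌋<n (suc n))) =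
  ≤-trans (*-monoʳ-≤ 2 lower) (2*⌊n/2⌋≤n (suc (suc n))) ,
  ≤-trans (n≤2*⌈n/2⌉ (suc (suc (suc n)))) (*-monoʳ-≤ 2 upper)

n<2^bitLength : ∀ n → n < 2 ^ bitLength n
n<2^bitLength zero    = s≤s z≤n
n<2^bitLength (suc n) = proj₂ (2^⌊log2⌋-bounds n (<-wellFounded (suc n)))

2^bitLength-least : ∀ n m → 1 ≤ m → (∀ k → 2 ^ k ≤ n → 2 ^ suc k ∣ m) → 2 ^ bitLength n ≤ m
2^bitLength-least zero    m 1≤m _         = 1≤m
2^bitLength-least (suc n) m 1≤m divisible =
  ∣⇒≤ {{>-nonZero 1≤m}} (divisible ⌊log₂ suc n ⌋ (proj₁ (2^⌊log2⌋-bounds n (<-wellFounded (suc n)))))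

xorScan-true-period-≥ : ∀ x m → 1 ≤ m → fold x (xorScan true) m ≡ x → 2 ^ bitLength (length x) ≤ m
xorScan-true-period-≥ x m 1≤m fixed =
  2^bitLength-least (length x) m 1≤m (λ k 2^k≤ → xorScan-true-period-divisible k x m 2^k≤ fixed)

code : List Bool → Path
code []          = U ∷ D ∷ []
code (false ∷ x) = code x ++ U ∷ D ∷ []
code (true ∷ x)  = U ∷ code x ++ D ∷ []

replicate-∷ʳ : ∀ {A : Set} k (a : A) → replicate k a ∷ʳ a ≡ a ∷ replicate k a
replicate-∷ʳ zero    a = refl
replicate-∷ʳ (suc k) a = cong (a ∷_) (replicate-∷ʳ k a)

UDs-∷ʳ : ∀ k → UDs k ++ U ∷ D ∷ [] ≡ UDs (suc k)
UDs-∷ʳ zero    = refl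
UDs-∷ʳ (suc k) = cong (λ p → U ∷ D ∷ p) (UDs-∷ʳ k)

code-zeros : ∀ k y → code (replicate k false ++ y) ≡ code y ++ UDs k
code-zeros zero    y = sym (++-identityʳ (code y))
code-zeros (suc k) y = begin
  code (replicate k false ++ y) ++ U ∷ D ∷ []  ≡⟨ cong (_++ U ∷ D ∷ []) (code-zeros k y) ⟩
  (code y ++ UDs k) ++ U ∷ D ∷ []             ≡⟨ ++-assoc (code y) (UDs k) (U ∷ D ∷ []) ⟩
  code y ++ UDs k ++ U ∷ D ∷ []               ≡⟨ cong (code y ++_) (UDs-∷ʳ k) ⟩
  code y ++ UDs (suc k)                       ∎
  where open ≡-Reasoning

code-all-zeros : ∀ k → code (replicate k false) ≡ UDs (suc k)
code-all-zeros k = trans (cong code (sym (++-identityʳ (replicate k false)))) (code-zeros k [])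

code-ones : ∀ k y → code (replicate k true ++ y) ≡ Us k ++ code y ++ Ds k
code-ones zero    y = sym (++-identityʳ (code y))
code-ones (suc k) y = cong (U ∷_) (begin
  code (replicate k true ++ y) ++ D ∷ []  ≡⟨ cong (_++ D ∷ []) (code-ones k y) ⟩
  (Us k ++ code y ++ Ds k) ++ D ∷ []      ≡⟨ ++-assoc (Us k) (code y ++ Ds k) (D ∷ []) ⟩
  Us k ++ (code y ++ Ds k) ++ D ∷ []      ≡⟨ cong (Us k ++_) (++-assoc (code y) (Ds k) (D ∷ [])) ⟩
  Us k ++ code y ++ Ds k ∷ʳ D             ≡⟨ cong (λ p → Us k ++ code y ++ p) (replicate-∷ʳ k D) ⟩
  Us k ++ code y ++ D ∷ Ds k              ∎)
  where open ≡-Reasoning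

code-all-ones : ∀ k → code (replicate k true) ≡ Us (suc k) ++ Ds (suc k)
code-all-ones zero    = refl
code-all-ones (suc k) = cong (U ∷_) (begin
  code (replicate k true) ++ D ∷ []    ≡⟨ cong (_++ D ∷ []) (code-all-ones k) ⟩
  (Us (suc k) ++ Ds (suc k)) ++ D ∷ [] ≡⟨ ++-assoc (Us (suc k)) (Ds (suc k)) (D ∷ []) ⟩
  Us (suc k) ++ Ds (suc k) ∷ʳ D        ≡⟨ cong (Us (suc k) ++_) (replicate-∷ʳ (suc k) D) ⟩
  Us (suc k) ++ D ∷ Ds (suc k)         ∎)
  where open ≡-Reasoning

code-∷ʳD : ∀ x → ∃[ p ] code x ≡ p ∷ʳ D
code-∷ʳD []          = U ∷ [] , refl
code-∷ʳD (false ∷ x) = code x ∷ʳ U , sym (++-assoc (code x) (U ∷ []) (D ∷ []))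
code-∷ʳD (true ∷ x)  = U ∷ code x , refl

size-++ : ∀ p q → size (p ++ q) ≡ size p + size q
size-++ []      q = refl
size-++ (U ∷ p) q = cong suc (size-++ p q)
size-++ (D ∷ p) q = size-++ p q

size-code : ∀ x → size (code x) ≡ suc (length x)
size-code []          = refl
size-code (false ∷ x) = begin
  size (code x ++ U ∷ D ∷ [])  ≡⟨ size-++ (code x) (U ∷ D ∷ []) ⟩
  size (code x) + 1            ≡⟨ cong (_+ 1) (size-code x) ⟩
  suc (length x) + 1           ≡⟨ +-comm (suc (length x)) 1 ⟩
  suc (suc (length x))         ∎
  where open ≡-Reasoning
size-code (true ∷ x)  = cong suc (begin
  size (code x ++ D ∷ [])  ≡⟨ size-++ (code x) (D ∷ []) ⟩
  size (code x) + 0        ≡⟨ +-identityʳ _ ⟩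
  size (code x)            ≡⟨ size-code x ⟩
  suc (length x)           ∎)
  where open ≡-Reasoning

code-nonempty : ∀ x → code x ≢ []
code-nonempty x e with () ← trans (sym (size-code x)) (cong size e)

code-wrap≢code-append : ∀ x y → code (true ∷ x) ≢ code (false ∷ y)
code-wrap≢code-append x y e with p , ends-D ← code-∷ʳD x with () ←
  ∷ʳ-injectiveʳ (U ∷ p) (code y) (trans (cong (U ∷_) (sym ends-D))
    (∷ʳ-injectiveˡ (U ∷ code x) (code y ∷ʳ U) (trans e (sym (++-assoc (code y) (U ∷ []) (D ∷ []))))))

code-injective : ∀ x y → code x ≡ code y → x ≡ y
code-injective []          []          _ = refl
code-injective (false ∷ x) (false ∷ y) e =
  cong (false ∷_) (code-injective x y (++-cancelʳ (U ∷ D ∷ []) (code x) (code y) e))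
code-injective (true ∷ x)  (true ∷ y)  e =
  cong (true ∷_) (code-injective x y (++-cancelʳ (D ∷ []) (code x) (code y) (∷-injectiveʳ e)))
code-injective (true ∷ x)  (false ∷ y) e = contradiction e (code-wrap≢code-append x y)
code-injective (false ∷ x) (true ∷ y)  e = sym (code-injective (true ∷ y) (false ∷ x) (sym e))
code-injective []          (b ∷ y)     e
  with () ← trans (sym (size-code [])) (trans (cong size e) (size-code (b ∷ y)))
code-injective (b ∷ x)     []          e
  with () ← trans (sym (size-code [])) (trans (cong size (sym e)) (size-code (b ∷ x)))

walk-U : ∀ h w → walk h (U ∷ w) ≡ walk (suc h) w
walk-U zero    w = refl
walk-U (suc h) w = refl

walk-++ : ∀ k h p q → walk k p ≡ true → walk (k + h) (p ++ q) ≡ walk h q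
walk-++ zero    h []      q _  = refl
walk-++ (suc k) h []      q ()
walk-++ k       h (U ∷ p) q e  =
  trans (walk-U (k + h) (p ++ q)) (walk-++ (suc k) h p q (trans (sym (walk-U k p)) e))
walk-++ zero    h (D ∷ p) q ()
walk-++ (suc k) h (D ∷ p) q e  = walk-++ k h p q e

code-isDyck : ∀ x → IsDyck (code x)
code-isDyck []          = refl
code-isDyck (false ∷ x) = walk-++ 0 0 (code x) (U ∷ D ∷ []) (code-isDyck x)
code-isDyck (true ∷ x)  = walk-++ 0 1 (code x) (D ∷ []) (code-isDyck x)

first-return : ∀ k w → walk (suc k) w ≡ true →
  ∃[ p ] ∃[ s ] w ≡ p ++ D ∷ s × walk k p ≡ true × IsDyck s
first-return k       []      ()
first-return k       (U ∷ w) e with p , s , refl , wp , ws ← first-return (suc k) w e =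
  U ∷ p , s , refl , trans (walk-U k p) wp , ws
first-return zero    (D ∷ w) e = [] , w , refl , refl , e
first-return (suc k) (D ∷ w) e with p , s , refl , wp , ws ← first-return k w e =
  D ∷ p , s , refl , wp , ws

avoidsDUU-suffix : ∀ p w → AvoidsDUU (p ++ w) → AvoidsDUU w
avoidsDUU-suffix p w av (a , b , refl) = av (p ++ a , b , sym (++-assoc p a _))

avoidsDUU-prefix : ∀ w q → AvoidsDUU (w ++ q) → AvoidsDUU w
avoidsDUU-prefix w q av (a , b , refl) = av (a , b ++ q , ++-assoc a (D ∷ U ∷ U ∷ b) q)

peaks-after-D : ∀ s → IsDyck s → AvoidsDUU (D ∷ s) → ∃[ j ] s ≡ UDs j
peaks-after-D []          _  _  = 0 , refl
peaks-after-D (D ∷ s)     () _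
peaks-after-D (U ∷ [])    () _
peaks-after-D (U ∷ U ∷ s) _  av = contradiction ([] , s , refl) av
peaks-after-D (U ∷ D ∷ s) e  av with j , refl ← peaks-after-D s e (avoidsDUU-suffix (D ∷ U ∷ []) (D ∷ s) av) =
  suc j , refl

dyck-avoidsDUU⇒code : ∀ N p → length p ≤ N → IsDyck p → AvoidsDUU p → p ≡ [] ⊎ ∃[ x ] p ≡ code x
dyck-avoidsDUU⇒code N       []      _          _ _  = inj₁ refl
dyck-avoidsDUU⇒code N       (D ∷ p) _          () _
dyck-avoidsDUU⇒code (suc N) (U ∷ p) (s≤s len≤) e av
  with q , s , refl , wq , ws ← first-return 0 p e
  with j , refl ← peaks-after-D s ws (avoidsDUU-suffix (U ∷ q) (D ∷ s) av)
  with dyck-avoidsDUU⇒code N q (≤-trans (length-++-≤ˡ q) len≤) wq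
         (avoidsDUU-prefix q (D ∷ UDs j) (avoidsDUU-suffix (U ∷ []) (q ++ D ∷ UDs j) av))
... | inj₁ refl       = inj₂ (replicate j false , sym (code-all-zeros j))
... | inj₂ (x , refl) = inj₂ (replicate j false ++ true ∷ x ,
                              trans (sym (++-assoc (U ∷ code x) (D ∷ []) (UDs j))) (sym (code-zeros j (true ∷ x))))

primDUU⇒code : ∀ n w → 2 ≤ n → PrimDUU n w → ∃[ x ] w ≡ code (true ∷ x) × length x ≡ n ∸ 2
primDUU⇒code n w 2≤n ((dyck , nonempty , indecomposable) , av , refl)
  with dyck-avoidsDUU⇒code (length w) w ≤-refl dyck av
... | inj₁ refl                 = contradiction refl nonempty
... | inj₂ ([] , refl)          with s≤s () ← 2≤n
... | inj₂ (false ∷ x , refl)   =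
  contradiction (code-isDyck x) (indecomposable (code x) (U ∷ D ∷ []) refl (code-nonempty x) (λ ()))
... | inj₂ (true ∷ x , refl)    = x , refl , cong (_∸ 2) (sym (size-code (true ∷ x)))

comps-inside : ∀ k h cur p r → walk k p ≡ true →
  comps (suc (k + h)) cur (p ++ r) ≡ comps (suc h) (p ʳ++ cur) r
comps-inside zero    h cur []      r _  = refl
comps-inside (suc k) h cur []      r ()
comps-inside k       h cur (U ∷ p) r e  = comps-inside (suc k) h (U ∷ cur) p r (trans (sym (walk-U k p)) e)
comps-inside zero    h cur (D ∷ p) r ()
comps-inside (suc k) h cur (D ∷ p) r e  = comps-inside k h (D ∷ cur) p r e

components-wrap : ∀ p r → IsDyck p → components (U ∷ p ++ D ∷ r) ≡ (U ∷ p ++ D ∷ []) ∷ components r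
components-wrap p r e =
  trans (comps-inside 0 0 (U ∷ []) p (D ∷ r) e) (cong (_∷ components r) (ʳ++-ʳ++ p))

components-code-wrap : ∀ x → components (code (true ∷ x)) ≡ code (true ∷ x) ∷ []
components-code-wrap x = components-wrap (code x) [] (code-isDyck x)

components-UDs : ∀ k → components (UDs k) ≡ replicate k (U ∷ D ∷ [])
components-UDs zero    = refl
components-UDs (suc k) = cong ((U ∷ D ∷ []) ∷_) (components-UDs k)

interior-wrap : ∀ p → interior (U ∷ p ++ D ∷ []) ≡ p
interior-wrap []          = refl
interior-wrap (a ∷ [])    = refl
interior-wrap (a ∷ b ∷ p) = cong (a ∷_) (interior-wrap (b ∷ p))

stripUD-DU : ∀ w → stripUD (D ∷ U ∷ w) ≡ map₁ suc (stripUD w)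
stripUD-DU w with stripUD w
... | i , q = refl

reverse-UDs-suc : ∀ k → reverse (UDs (suc k)) ≡ D ∷ U ∷ reverse (UDs k)
reverse-UDs-suc k = trans (cong reverse (sym (UDs-∷ʳ k))) (reverse-++ (UDs k) (U ∷ D ∷ []))

stripUD-reverse-UDs : ∀ k q → stripUD (reverse q) ≡ (0 , reverse q) →
  stripUD (reverse (q ++ UDs k)) ≡ (k , reverse q)
stripUD-reverse-UDs k q stops = trans (cong stripUD (reverse-++ q (UDs k))) (strip k)
  where
  strip : ∀ k → stripUD (reverse (UDs k) ++ reverse q) ≡ (k , reverse q)
  strip zero    = stops
  strip (suc k) = begin
    stripUD (reverse (UDs (suc k)) ++ reverse q)      ≡⟨ cong (λ p → stripUD (p ++ reverse q)) (reverse-UDs-suc k) ⟩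
    stripUD (D ∷ U ∷ reverse (UDs k) ++ reverse q)    ≡⟨ stripUD-DU (reverse (UDs k) ++ reverse q) ⟩
    map₁ suc (stripUD (reverse (UDs k) ++ reverse q)) ≡⟨ cong (map₁ suc) (strip k) ⟩
    (suc k , reverse q)                               ∎
    where open ≡-Reasoning

stripUD-reverse-code-wrap : ∀ y → stripUD (reverse (code (true ∷ y))) ≡ (0 , reverse (code (true ∷ y)))
stripUD-reverse-code-wrap y with p , ends-D ← code-∷ʳD y =
  subst (λ w → stripUD w ≡ (0 , w)) (sym reverse≡DD) refl
  where
  reverse≡DD : reverse (code (true ∷ y)) ≡ D ∷ D ∷ reverse (U ∷ p)
  reverse≡DD = begin
    reverse ((U ∷ code y) ∷ʳ D)  ≡⟨ reverse-++ (U ∷ code y) (D ∷ []) ⟩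
    D ∷ reverse (U ∷ code y)     ≡⟨ cong (λ w → D ∷ reverse (U ∷ w)) ends-D ⟩
    D ∷ reverse ((U ∷ p) ∷ʳ D)   ≡⟨ cong (D ∷_) (reverse-++ (U ∷ p) (D ∷ [])) ⟩
    D ∷ D ∷ reverse (U ∷ p)      ∎
    where open ≡-Reasoning

Ffuel-[] : ∀ f → Ffuel f [] ≡ []
Ffuel-[] zero    = refl
Ffuel-[] (suc f) = refl

Ffuel-UD : ∀ f → Ffuel (suc f) (U ∷ D ∷ []) ≡ U ∷ D ∷ []
Ffuel-UD f = cong (λ p → U ∷ p ++ D ∷ []) (Ffuel-[] f)

Ffuel-components : ∀ f w p q ps → components w ≡ p ∷ q ∷ ps →
  Ffuel (suc f) w ≡ concat (map (Ffuel f) (p ∷ q ∷ ps))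
Ffuel-components f w p q ps e rewrite e = refl

Ffuel-primitive-peaks : ∀ f P i → components P ≡ P ∷ [] → stripUD (reverse (interior P)) ≡ (i , []) →
  Ffuel (suc f) P ≡ Us (suc i) ++ Ds (suc i)
Ffuel-primitive-peaks f P i prim strip rewrite prim | strip =
  cong (λ p → Us (suc i) ++ p ++ Ds (suc i)) (Ffuel-[] f)

Ffuel-primitive-wrap : ∀ f P i rq Q → components P ≡ P ∷ [] → stripUD (reverse (interior P)) ≡ (i , rq) →
  components (reverse rq) ≡ Q ∷ [] →
  Ffuel (suc f) P ≡ Us (suc i) ++ Ffuel f (interior Q) ++ U ∷ D ∷ Ds (suc i)
Ffuel-primitive-wrap f P i rq Q prim strip primQ rewrite prim | strip | primQ = refl

concat-Ffuel-peaks : ∀ f k → concat (map (Ffuel (suc f)) (replicate k (U ∷ D ∷ []))) ≡ UDs k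
concat-Ffuel-peaks f zero    = refl
concat-Ffuel-peaks f (suc k) = cong₂ _++_ (Ffuel-UD f) (concat-Ffuel-peaks f k)

Ffuel-UDs : ∀ f k → Ffuel (suc (suc f)) (UDs k) ≡ UDs k
Ffuel-UDs f zero          = refl
Ffuel-UDs f (suc zero)    = Ffuel-UD (suc f)
Ffuel-UDs f (suc (suc k)) =
  trans (Ffuel-components (suc f) (UDs (suc (suc k))) _ _ _ (components-UDs (suc (suc k))))
        (concat-Ffuel-peaks f (suc (suc k)))

Ffuel-wrap-++-UDs : ∀ f p j → IsDyck p →
  Ffuel (suc (suc f)) ((U ∷ p ++ D ∷ []) ++ UDs (suc j)) ≡ Ffuel (suc f) (U ∷ p ++ D ∷ []) ++ UDs (suc j)
Ffuel-wrap-++-UDs f p j dyck =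
  trans (Ffuel-components (suc f) (P ++ UDs (suc j)) P (U ∷ D ∷ []) (replicate j (U ∷ D ∷ [])) comps≡)
        (cong (Ffuel (suc f) P ++_) (concat-Ffuel-peaks f (suc j)))
  where
  P = U ∷ p ++ D ∷ []
  comps≡ : components (P ++ UDs (suc j)) ≡ P ∷ replicate (suc j) (U ∷ D ∷ [])
  comps≡ = trans (cong (λ w → components (U ∷ w)) (++-assoc p (D ∷ []) (UDs (suc j))))
                 (trans (components-wrap p (UDs (suc j)) dyck) (cong (P ∷_) (components-UDs (suc j))))

Ffuel-code-10ᵏ : ∀ f k → Ffuel (suc f) (code (true ∷ replicate k false)) ≡ code (true ∷ replicate k true)
Ffuel-code-10ᵏ f k =
  trans (Ffuel-primitive-peaks f _ (suc k) (components-code-wrap (replicate k false)) strip)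
        (sym (code-all-ones (suc k)))
  where
  strip : stripUD (reverse (interior (code (true ∷ replicate k false)))) ≡ (suc k , [])
  strip = trans (cong (stripUD ∘ reverse) (trans (interior-wrap (code (replicate k false))) (code-all-zeros k)))
                (stripUD-reverse-UDs (suc k) [] refl)

Ffuel-code-10ᵏ1 : ∀ f k y →
  Ffuel (suc f) (code (true ∷ replicate k false ++ true ∷ y)) ≡
  Us (suc k) ++ Ffuel f (code y) ++ U ∷ D ∷ Ds (suc k)
Ffuel-code-10ᵏ1 f k y =
  trans (Ffuel-primitive-wrap f _ k (reverse Q) Q
           (components-code-wrap (replicate k false ++ true ∷ y)) strip primQ)
        (cong (λ p → Us (suc k) ++ Ffuel f p ++ U ∷ D ∷ Ds (suc k)) (interior-wrap (code y)))
  where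
  Q = code (true ∷ y)
  strip : stripUD (reverse (interior (code (true ∷ replicate k false ++ true ∷ y)))) ≡ (k , reverse Q)
  strip = trans (cong (stripUD ∘ reverse) (trans (interior-wrap (code (replicate k false ++ true ∷ y)))
                                                   (code-zeros k (true ∷ y))))
                (stripUD-reverse-UDs k Q (stripUD-reverse-code-wrap y))
  primQ : components (reverse (reverse Q)) ≡ Q ∷ []
  primQ = trans (cong components (reverse-involutive Q)) (components-code-wrap y)

data ZeroRun : List Bool → Set where
  zeros          : ∀ j → ZeroRun (replicate j false)
  zeros-then-one : ∀ j y → ZeroRun y → ZeroRun (replicate j false ++ true ∷ y)

zeroRun : ∀ x → ZeroRun x
zeroRun []          = zeros 0
zeroRun (true ∷ x)  = zeros-then-one 0 x (zeroRun x)
zeroRun (false ∷ x) with zeroRun x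
... | zeros j              = zeros (suc j)
... | zeros-then-one j y v = zeros-then-one (suc j) y v

xorScan-zeros : ∀ c j w → xorScan c (replicate j false ++ w) ≡ replicate j c ++ xorScan c w
xorScan-zeros c zero    w = refl
xorScan-zeros c (suc j) w rewrite xor-identityʳ c = cong (c ∷_) (xorScan-zeros c j w)

xorScan-all-zeros : ∀ c j → xorScan c (replicate j false) ≡ replicate j c
xorScan-all-zeros c zero    = refl
xorScan-all-zeros c (suc j) rewrite xor-identityʳ c = cong (c ∷_) (xorScan-all-zeros c j)

mutual
  Ffuel-code-wrap : ∀ {y} → ZeroRun y → ∀ f → suc (length y) < f →
    Ffuel (suc f) (code (true ∷ y)) ≡ code (true ∷ xorScan true y)
  Ffuel-code-wrap (zeros k)            f _     = begin
    Ffuel (suc f) (code (true ∷ replicate k false))  ≡⟨ Ffuel-code-10ᵏ f k ⟩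
    code (true ∷ replicate k true)                   ≡⟨ cong (λ z → code (true ∷ z)) (xorScan-all-zeros true k) ⟨
    code (true ∷ xorScan true (replicate k false))   ∎
    where open ≡-Reasoning
  Ffuel-code-wrap (zeros-then-one k y v) f bound = begin
    Ffuel (suc f) (code (true ∷ replicate k false ++ true ∷ y))
      ≡⟨ Ffuel-code-10ᵏ1 f k y ⟩
    Us (suc k) ++ Ffuel f (code y) ++ U ∷ D ∷ Ds (suc k)
      ≡⟨ cong (λ p → Us (suc k) ++ p ++ U ∷ D ∷ Ds (suc k)) (Ffuel-code v f bound′) ⟩
    Us (suc k) ++ code z ++ U ∷ D ∷ Ds (suc k)
      ≡⟨ cong (Us (suc k) ++_) (++-assoc (code z) (U ∷ D ∷ []) (Ds (suc k))) ⟨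
    Us (suc k) ++ code (false ∷ z) ++ Ds (suc k)
      ≡⟨ code-ones (suc k) (false ∷ z) ⟨
    code (true ∷ replicate k true ++ false ∷ z)
      ≡⟨ cong (λ w → code (true ∷ w)) (xorScan-zeros true k (true ∷ y)) ⟨
    code (true ∷ xorScan true (replicate k false ++ true ∷ y)) ∎
    where
    open ≡-Reasoning
    z = xorScan false y
    bound′ : suc (length y) < f
    bound′ = ≤-trans (s≤s (s≤s (≤-trans (n≤1+n (length y))
                                        (length-++-≤ʳ (true ∷ y) {replicate k false})))) bound

  Ffuel-code : ∀ {x} → ZeroRun x → ∀ f → suc (length x) < f → Ffuel f (code x) ≡ code (xorScan false x)
  Ffuel-code (zeros j) (suc zero) (s≤s ())
  Ffuel-code (zeros j) (suc (suc f)) _ = begin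
    Ffuel (suc (suc f)) (code (replicate j false)) ≡⟨ cong (Ffuel (suc (suc f))) (code-all-zeros j) ⟩
    Ffuel (suc (suc f)) (UDs (suc j))              ≡⟨ Ffuel-UDs f (suc j) ⟩
    UDs (suc j)                                    ≡⟨ code-all-zeros j ⟨
    code (replicate j false)                       ≡⟨ cong code (xorScan-all-zeros false j) ⟨
    code (xorScan false (replicate j false))       ∎
    where open ≡-Reasoning
  Ffuel-code (zeros-then-one zero y v) (suc f) (s≤s bound) = Ffuel-code-wrap v f bound
  Ffuel-code (zeros-then-one (suc j) y v) (suc zero) (s≤s ())
  Ffuel-code (zeros-then-one (suc j) y v) (suc (suc f)) (s≤s (s≤s bound)) = begin
    Ffuel (suc (suc f)) (code (replicate (suc j) false ++ true ∷ y))
      ≡⟨ cong (Ffuel (suc (suc f))) (code-zeros (suc j) (true ∷ y)) ⟩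
    Ffuel (suc (suc f)) (code (true ∷ y) ++ UDs (suc j))
      ≡⟨ Ffuel-wrap-++-UDs f (code y) j (code-isDyck y) ⟩
    Ffuel (suc f) (code (true ∷ y)) ++ UDs (suc j)
      ≡⟨ cong (_++ UDs (suc j)) (Ffuel-code-wrap v f bound′) ⟩
    code (true ∷ xorScan true y) ++ UDs (suc j)
      ≡⟨ code-zeros (suc j) (true ∷ xorScan true y) ⟨
    code (replicate (suc j) false ++ true ∷ xorScan true y)
      ≡⟨ cong code (xorScan-zeros false (suc j) (true ∷ y)) ⟨
    code (xorScan false (replicate (suc j) false ++ true ∷ y)) ∎
    where
    open ≡-Reasoning
    bound′ : suc (length y) < f
    bound′ = ≤-trans (s≤s (length-++-≤ʳ (true ∷ y) {replicate j false})) bound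

length-code : ∀ x → suc (length x) < length (code x)
length-code []          = s≤s (s≤s z≤n)
length-code (false ∷ x) = begin
  suc (suc (suc (length x)))  ≤⟨ s≤s (length-code x) ⟩
  suc (length (code x))       ≤⟨ n≤1+n _ ⟩
  2 + length (code x)         ≡⟨ +-comm 2 (length (code x)) ⟩
  length (code x) + 2         ≡⟨ length-++ (code x) ⟨
  length (code (false ∷ x))   ∎
  where open ≤-Reasoning
length-code (true ∷ x)  = s≤s (≤-trans (length-code x) (length-++-≤ˡ (code x)))

F-code : ∀ x → F (code x) ≡ code (xorScan false x)
F-code x = Ffuel-code (zeroRun x) (length (code x)) (length-code x)

F^-code-wrap : ∀ m x → F^ m (code (true ∷ x)) ≡ code (true ∷ fold x (xorScan true) m)
F^-code-wrap zero    x = refl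
F^-code-wrap (suc m) x = begin
  F (F^ m (code (true ∷ x)))                           ≡⟨ cong F (F^-code-wrap m x) ⟩
  F (code (true ∷ fold x (xorScan true) m))            ≡⟨ F-code (true ∷ fold x (xorScan true) m) ⟩
  code (true ∷ fold x (xorScan true) (suc m))          ∎
  where open ≡-Reasoning

code-wrap-orbit : ∀ x → OrbitLength (code (true ∷ x)) (2 ^ bitLength (length x))
code-wrap-orbit x = m^n>0 2 B , period , minimal
  where
  B = bitLength (length x)
  fixed : ∀ m → F^ m (code (true ∷ x)) ≡ code (true ∷ x) → fold x (xorScan true) m ≡ x
  fixed m e = ∷-injectiveʳ (code-injective (true ∷ fold x (xorScan true) m) (true ∷ x)
                                           (trans (sym (F^-code-wrap m x)) e))
  period : F^ (2 ^ B) (code (true ∷ x)) ≡ code (true ∷ x)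
  period = trans (F^-code-wrap (2 ^ B) x)
                 (cong (λ z → code (true ∷ z)) (xorScan-true-period B x (n<2^bitLength (length x))))
  minimal : ∀ m → 1 ≤ m → m < 2 ^ B → F^ m (code (true ∷ x)) ≢ code (true ∷ x)
  minimal m 1≤m m<2^B e = <⇒≱ m<2^B (xorScan-true-period-≥ x m 1≤m (fixed m e))

corollary7 : ∀ (n : ℕ) → 2 ≤ n → ∀ (w : Path) → PrimDUU n w →
    OrbitLength w (2 ^ bitLength (n ∸ 2))
corollary7 n 2≤n w pd with x , refl , len ← primDUU⇒code n w 2≤n pd =
  subst (λ l → OrbitLength (code (true ∷ x)) (2 ^ bitLength l)) len (code-wrap-orbit x)
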